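{- Let $G$ be a connected graph of order $n\ge 2$, and let $k$ be a positive integer. Then $\dim_{k,f}(G)=\frac{n}{2}$ if and only if $G\in H[\mathcal{K}\cup\overline{\mathcal{K}}]$ for some connected graph $H$.
   Context: All graphs are finite, simple, undirected and connected. $d(x,y)$ denotes the distance in $G$. For a positive integer $k$, $d_k(x,y)=\min\{d(x,y),k+1\}$, and for distinct $x,y\in V(G)$, $R_k\{x,y\}=\{z\in V(G): d_k(x,z)\neq d_k(y,z)\}$. For $g$ defined on $V(G)$ and $U\subseteq V(G)$, $g(U)=\sum_{s\in U}g(s)$. A function $h:V(G)\to[0,1]$ is a $k$-truncated resolving function of $G$ if $h(R_k\{x,y\})\ge 1$ for all distinct $x,y\in V(G)$; $\dim_{k,f}(G)=\min\{h(V(G)): h \text{ is a } k\text{ -truncated resolving function of } G\}$. Let $\mathcal{K}=\{K_a: a\ge 2\}$ (complete graphs) and $\overline{\mathcal{K}}=\{\overline{K}_b: b\ge2\}$ (edgeless graphs). For a connected graph $H$, $H[\mathcal{K}\cup\overline{\mathcal{K}}]$ is the family of graphs obtained from $H$ by replacing each vertex $u_i\in V(H)$ by a graph $H_i\in\mathcal{K}\cup\overline{\mathcal{K}}$, where each vertex of $H_i$ is adjacent to each vertex of $H_j$ ($i\ne j$) if and only if $u_iu_j\in E(H)$.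
   Formalization: The k-truncated resolving functions defining $\dim_{k,f}(G)$ take rational values in [0,1] instead of real values. -}

module Defs where

open import Data.Nat as ℕ using (ℕ; zero; suc; _⊓_)
open import Data.Fin using (Fin; zero; suc; _≟_)
open import Data.Bool using (Bool; true; false; if_then_else_; _∨_; _∧_; not)
open import Data.List using (allFin)
open import Data.Bool.ListAction using (any)
open import Data.Integer using (+_)
open import Data.Rational using (ℚ; 0ℚ; 1ℚ; _+_; _≤_; _/_)
open import Data.Product using (Σ; _×_; _,_)
open import Data.Sum using (_⊎_)
open import Relation.Nullary using (¬_)
open import Relation.Nullary.Decidable using (⌊_⌋)
open import Relation.Binary.PropositionalEquality using (_≡_)

record Graph (n : ℕ) : Set where
  field
    adj    : Fin n → Fin n → Bool
    sym    : ∀ i j → adj i j ≡ adj j i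
    irrefl : ∀ i → adj i i ≡ false
open Graph public

reach : ∀ {n} → Graph n → ℕ → Fin n → Fin n → Bool
reach G zero    x y = ⌊ x ≟ y ⌋
reach G (suc m) x y = reach G m x y ∨ any (λ z → reach G m x z ∧ adj G z y) (allFin _)

Connected : ∀ {n} → Graph n → Set
Connected {n} G = ∀ (x y : Fin n) → Σ ℕ (λ m → reach G m x y ≡ true)

-- least i < b with p i = true (and b if there is none)
leastBelow : ℕ → (ℕ → Bool) → ℕ
leastBelow zero    p = zero
leastBelow (suc b) p = if p zero then zero else suc (leastBelow b (λ i → p (suc i)))

-- Distance d(x,y): least m with a walk of length ≤ m from x to y.
-- (In a connected graph on n vertices, d(x,y) ≤ n - 1 < n, so the search bound n suffices.)
dist : ∀ {n} → Graph n → Fin n → Fin n → ℕ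
dist {n} G x y = leastBelow n (λ m → reach G m x y)

distT : ∀ {n} → Graph n → ℕ → Fin n → Fin n → ℕ
distT G k x y = dist G x y ⊓ suc k

inR : ∀ {n} → Graph n → ℕ → Fin n → Fin n → Fin n → Bool
inR G k x y z = not (distT G k x z ℕ.≡ᵇ distT G k y z)

sumFin : ∀ {n} → (Fin n → ℚ) → ℚ
sumFin {zero}  g = 0ℚ
sumFin {suc n} g = g zero + sumFin (λ i → g (suc i))

sumOver : ∀ {n} → (Fin n → Bool) → (Fin n → ℚ) → ℚ
sumOver U g = sumFin (λ s → if U s then g s else 0ℚ)

IsTruncResolving : ∀ {n} → Graph n → ℕ → (Fin n → ℚ) → Set
IsTruncResolving {n} G k h =
  (∀ s → (0ℚ ≤ h s) × (h s ≤ 1ℚ)) ×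
  (∀ (x y : Fin n) → ¬ (x ≡ y) → 1ℚ ≤ sumOver (inR G k x y) h)

DimKF≡ : ∀ {n} → Graph n → ℕ → ℚ → Set
DimKF≡ {n} G k r =
  Σ (Fin n → ℚ) (λ h → IsTruncResolving G k h × sumFin h ≡ r) ×
  (∀ (h : Fin n → ℚ) → IsTruncResolving G k h → r ≤ sumFin h)

-- G ∈ H[𝒦 ∪ 𝒦̄] for the connected graph H on Fin m: the map π sends each vertex of G
-- to the vertex u_i of H whose blown-up copy H_i contains it.
InBlowup : ∀ {n m} → Graph n → Graph m → Set
InBlowup {n} {m} G H =
  Σ (Fin n → Fin m) λ π →
    (∀ (i : Fin m) → Σ (Fin n) λ x → Σ (Fin n) λ y → ¬ (x ≡ y) × π x ≡ i × π y ≡ i) ×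
    (∀ (i : Fin m) →
        (∀ x y → π x ≡ i → π y ≡ i → ¬ (x ≡ y) → adj G x y ≡ true) ⊎
        (∀ x y → π x ≡ i → π y ≡ i → adj G x y ≡ false)) ×
    (∀ x y → ¬ (π x ≡ π y) → adj G x y ≡ adj H (π x) (π y))

InSomeBlowup : ∀ {n} → Graph n → Set
InSomeBlowup G = Σ ℕ λ m → Σ (Graph m) λ H → Connected H × InBlowup G H

{-# OPTIONS --safe #-}
-- Call x and y twins when they have the same neighbours outside {x, y}. Twins are
-- equidistant from every other vertex, so R_k{x,y} = {x,y} and every resolving function
-- has h x + h y ≥ 1. If every vertex has a twin, the twin classes have at least two
-- elements each and these inequalities force h(V) ≥ n/2, while the constant ½ is always
-- resolving; so dim_{k,f}(G) = n/2. If some x has no twin, then for every y a third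
-- vertex is adjacent to exactly one of x and y, and since k ≥ 1 it tells distance 1 from
-- distance ≥ 2; hence ½ lowered to 0 at x is still resolving and dim_{k,f}(G) < n/2.
-- Finally, the graphs in which every vertex has a twin are exactly the blow-ups: the
-- fibres of a blow-up consist of twins, and conversely the twin classes are cliques or
-- independent sets blowing up the graph induced on a set of class representatives.

module Submission where

open import Defs hiding (sym)
open import Data.Bool as Bool using (Bool; true; false; not; _∧_; _∨_; if_then_else_)
open import Data.Bool.ListAction using (any)
open import Data.Bool.Properties using (T-≡; T-∨; T-∧; ¬-not; ∨-zeroʳ; ⇔→≡)
open import Data.Fin using (Fin; zero; suc; _≟_)
open import Data.Fin.Properties using (any?; all?; ¬∀⟶∃¬; suc-injective)
open import Data.Integer as ℤ using (+_)
import Data.Integer.Solver as ℤ-Solver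
open import Data.List using (allFin)
open import Data.List.Membership.Propositional using (lose)
open import Data.List.Membership.Propositional.Properties using (∈-allFin)
open import Data.List.Relation.Unary.Any using (satisfied)
open import Data.List.Relation.Unary.Any.Properties using (any⁺; any⁻)
open import Data.Nat as ℕ using (ℕ; zero; suc; s≤s)
open import Data.Nat.Properties using (≡⇒≡ᵇ)
open import Data.Product using (∃-syntax; _×_; _,_; proj₁; proj₂)
open import Data.Rational using (ℚ; 0ℚ; 1ℚ; ½; -½; _+_; _-_; -_; _≤_; _<_; _/_; toℚᵘ)
open import Data.Rational.Properties
  using (≤-refl; ≤-trans; ≤-reflexive; ≤-<-trans; <-irrefl; +-mono-≤; +-monoˡ-≤; +-monoʳ-≤; +-monoʳ-<; +-mono-<;
         +-comm; +-assoc; +-identityˡ; +-identityʳ; ≤ᵇ⇒≤; negative⁻¹; _≤?_; ≰⇒>;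
         toℚᵘ-injective; toℚᵘ-homo-+; toℚᵘ-fromℚᵘ; module ≤-Reasoning)
import Data.Rational.Unnormalised as ℚᵘ
import Data.Rational.Unnormalised.Properties as ℚᵘ
open import Data.Rational.Solver using (module +-*-Solver)
open import Data.Sum using (_⊎_; inj₁; inj₂)
open import Data.Vec.Functional using (updateAt)
open import Data.Vec.Functional.Properties using (updateAt-updates; updateAt-minimal)
open import Function using (_∘_; const)
open import Function.Bundles using (_⇔_; mk⇔; Equivalence)
import Function.Properties.Equivalence as ⇔
open import Relation.Binary using (Rel; IsDecEquivalence)
import Relation.Binary.Construct.On as On
open import Relation.Binary.PropositionalEquality hiding ([_])
open import Relation.Nullary using (¬_; yes; no; Dec; contradiction)
open import Relation.Nullary.Decidable using (toWitness; fromWitness; ¬?; _×-dec_; _→-dec_)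

open Equivalence using (to; from)

module _ {n} (G : Graph n) where

  reach-mono : ∀ m {x y} → reach G m x y ≡ true → reach G (suc m) x y ≡ true
  reach-mono m xy rewrite xy = refl

  reach-refl : ∀ m x → reach G m x x ≡ true
  reach-refl zero    x = to T-≡ (fromWitness {a? = x ≟ x} refl)
  reach-refl (suc m) x = reach-mono m (reach-refl m x)

  reach-step : ∀ m {x w y} → reach G m x w ≡ true → adj G w y ≡ true → reach G (suc m) x y ≡ true
  reach-step m {x} {w} {y} xw wy = trans (cong (reach G m x y ∨_) last-edge) (∨-zeroʳ _)
    where
    last-edge : any (λ z → reach G m x z ∧ adj G z y) (allFin n) ≡ true
    last-edge = to T-≡ (any⁺ _ (lose (∈-allFin w) (from T-≡ (cong₂ _∧_ xw wy))))

  reach-zero⁻ : ∀ {x y} → reach G 0 x y ≡ true → x ≡ y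
  reach-zero⁻ {x} {y} r = toWitness {a? = x ≟ y} (from T-≡ r)

  reach-suc⁻ : ∀ m {x y} → reach G (suc m) x y ≡ true →
    reach G m x y ≡ true ⊎ ∃[ w ] reach G m x w ≡ true × adj G w y ≡ true
  reach-suc⁻ m r with to T-∨ (from T-≡ r)
  ... | inj₁ xy  = inj₁ (to T-≡ xy)
  ... | inj₂ via with satisfied (any⁻ _ (allFin n) via)
  ...   | w , xwy with to T-∧ xwy
  ...     | xw , wy = inj₂ (w , to T-≡ xw , to T-≡ wy)

module _ {n m} {G : Graph n} {H : Graph m} (f : Fin n → Fin m)
         (edge : ∀ {x y} → adj G x y ≡ true → f x ≡ f y ⊎ adj H (f x) (f y) ≡ true) where

  reach-map : ∀ k {x y} → reach G k x y ≡ true → reach H k (f x) (f y) ≡ true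
  reach-map zero r with refl ← reach-zero⁻ G r = reach-refl H 0 _
  reach-map (suc k) {x} r with reach-suc⁻ G k r
  ... | inj₁ xy = reach-mono H k (reach-map k xy)
  ... | inj₂ (w , xw , wy) with edge wy
  ...   | inj₁ fw≡fy = reach-mono H k (subst (λ v → reach H k (f x) v ≡ true) fw≡fy (reach-map k xw))
  ...   | inj₂ fwfy  = reach-step H k (reach-map k xw) fwfy

  connected-image : (s : Fin m → Fin n) → (∀ i → f (s i) ≡ i) → Connected G → Connected H
  connected-image s f∘s≗id connected i j with connected (s i) (s j)
  ... | k , r = k , subst₂ (λ u v → reach H k u v ≡ true) (f∘s≗id i) (f∘s≗id j) (reach-map k r)

leastBelow-cong : ∀ b {p q : ℕ → Bool} → (∀ i → p i ≡ q i) → leastBelow b p ≡ leastBelow b q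
leastBelow-cong zero    p≗q = refl
leastBelow-cong (suc b) {p} {q} p≗q rewrite p≗q 0 with q 0
... | true  = refl
... | false = cong suc (leastBelow-cong b (p≗q ∘ suc))

leastBelow-hit : ∀ b (p : ℕ → Bool) → p 0 ≡ true → leastBelow (suc b) p ≡ 0
leastBelow-hit b p p0 rewrite p0 = refl

leastBelow-miss : ∀ b (p : ℕ → Bool) → p 0 ≡ false → leastBelow (suc b) p ≡ suc (leastBelow b (p ∘ suc))
leastBelow-miss b p p0 rewrite p0 = refl

-- Twins

Twins : ∀ {n} → Graph n → Fin n → Fin n → Set
Twins G x y = ∀ z → z ≢ x → z ≢ y → adj G x z ≡ adj G y z

HasTwin : ∀ {n} → Graph n → Fin n → Set
HasTwin G x = ∃[ y ] x ≢ y × Twins G x y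

EveryVertexHasTwin : ∀ {n} → Graph n → Set
EveryVertexHasTwin G = ∀ x → HasTwin G x

module _ {n} (G : Graph n) where

  private
    agree? : ∀ x y z → Dec (z ≢ x → z ≢ y → adj G x z ≡ adj G y z)
    agree? x y z = ¬? (z ≟ x) →-dec (¬? (z ≟ y) →-dec (adj G x z Bool.≟ adj G y z))

  twins? : ∀ x y → Dec (Twins G x y)
  twins? x y = all? (agree? x y)

  twins-sym : ∀ {x y} → Twins G x y → Twins G y x
  twins-sym xy z z≢y z≢x = sym (xy z z≢x z≢y)

  twins-trans : ∀ {x y z} → Twins G x y → Twins G y z → Twins G x z
  twins-trans {x} {y} {z} xy yz w w≢x w≢z with w ≟ y | x ≟ z
  ... | no w≢y   | _        = trans (xy w w≢x w≢y) (yz w w≢y w≢z)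
  ... | yes refl | yes refl = refl
  ... | yes refl | no x≢z   = begin
    adj G x w  ≡⟨ Graph.sym G x w ⟩
    adj G w x  ≡⟨ yz x (w≢x ∘ sym) x≢z ⟩
    adj G z x  ≡⟨ Graph.sym G z x ⟩
    adj G x z  ≡⟨ xy z (x≢z ∘ sym) (w≢z ∘ sym) ⟩
    adj G w z  ≡⟨ Graph.sym G w z ⟩
    adj G z w  ∎
    where open ≡-Reasoning

  twins-isDecEquivalence : IsDecEquivalence (Twins G)
  twins-isDecEquivalence = record
    { isEquivalence = record { refl = λ _ _ _ → refl ; sym = twins-sym ; trans = twins-trans }
    ; _≟_           = twins?
    }

  separating-vertex : ∀ {x y} → ¬ Twins G x y → ∃[ z ] z ≢ x × z ≢ y × adj G x z ≢ adj G y z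
  separating-vertex {x} {y} ¬xy with ¬∀⟶∃¬ n _ (agree? x y) ¬xy
  ... | z , disagree =
    z , (λ z≡x → disagree (λ z≢x → contradiction z≡x z≢x))
      , (λ z≡y → disagree (λ _ z≢y → contradiction z≡y z≢y))
      , (λ xz≡yz → disagree (λ _ _ → xz≡yz))

  adj-cong-twins : ∀ {x x′ y y′} → Twins G x x′ → Twins G y y′ → x ≢ y → x′ ≢ y′ →
    adj G x y ≡ adj G x′ y′
  adj-cong-twins {x} {x′} {y} {y′} xx′ yy′ x≢y x′≢y′ with y ≟ x′
  ... | no y≢x′ = begin
    adj G x y    ≡⟨ xx′ y (x≢y ∘ sym) y≢x′ ⟩
    adj G x′ y   ≡⟨ Graph.sym G x′ y ⟩
    adj G y x′   ≡⟨ yy′ x′ (y≢x′ ∘ sym) x′≢y′ ⟩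
    adj G y′ x′  ≡⟨ Graph.sym G y′ x′ ⟩
    adj G x′ y′  ∎
    where open ≡-Reasoning
  ... | yes refl with y′ ≟ x
  ...   | yes refl = Graph.sym G x y
  ...   | no y′≢x  = begin
    adj G x y    ≡⟨ Graph.sym G x y ⟩
    adj G y x    ≡⟨ yy′ x x≢y (y′≢x ∘ sym) ⟩
    adj G y′ x   ≡⟨ Graph.sym G y′ x ⟩
    adj G x y′   ≡⟨ xx′ y′ y′≢x (x′≢y′ ∘ sym) ⟩
    adj G y y′   ∎
    where open ≡-Reasoning

  -- A last step out of x can be taken out of y instead, unless it ends at y itself.
  twins-reach : ∀ {x y} → Twins G x y → ∀ m {z} → z ≢ x → reach G m x z ≡ true → reach G m y z ≡ true
  twins-reach xy zero z≢x r = contradiction (sym (reach-zero⁻ G r)) z≢x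
  twins-reach {x} {y} xy (suc m) {z} z≢x r with reach-suc⁻ G m r
  ... | inj₁ xz = reach-mono G m (twins-reach xy m z≢x xz)
  ... | inj₂ (w , xw , wz) with w ≟ x
  ...   | no w≢x = reach-step G m (twins-reach xy m w≢x xw) wz
  ...   | yes refl with z ≟ y
  ...     | yes refl = reach-refl G (suc m) z
  ...     | no z≢y   = reach-step G m (reach-refl G m y) (trans (sym (xy z z≢x z≢y)) wz)

  twins-dist : ∀ {x y z} → Twins G x y → z ≢ x → z ≢ y → dist G x z ≡ dist G y z
  twins-dist xy z≢x z≢y = leastBelow-cong n λ m →
    ⇔→≡ (mk⇔ (twins-reach xy m z≢x) (twins-reach (twins-sym xy) m z≢y))

-- dist searches for a walk length below the number of vertices, so telling distance 1
-- from distance 2 needs at least two of them.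
module _ {n} (G : Graph (suc (suc n))) where

  private
    walks : Fin (suc (suc n)) → Fin (suc (suc n)) → ℕ → Bool
    walks x z m = reach G m x z

    no-walk₀ : ∀ {x z} → x ≢ z → reach G 0 x z ≡ false
    no-walk₀ x≢z = ¬-not (x≢z ∘ reach-zero⁻ G)

  dist-refl : ∀ x → dist G x x ≡ 0
  dist-refl x = leastBelow-hit (suc n) (walks x x) (reach-refl G 0 x)

  dist-≢ : ∀ {x z} → x ≢ z → ∃[ d ] dist G x z ≡ suc d
  dist-≢ {x} {z} x≢z = _ , leastBelow-miss (suc n) (walks x z) (no-walk₀ x≢z)

  dist-adjacent : ∀ {x z} → x ≢ z → adj G x z ≡ true → dist G x z ≡ 1
  dist-adjacent {x} {z} x≢z xz =
    trans (leastBelow-miss (suc n) (walks x z) (no-walk₀ x≢z))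
          (cong suc (leastBelow-hit n (walks x z ∘ suc) (reach-step G 0 (reach-refl G 0 x) xz)))

  dist-nonadjacent : ∀ {x z} → x ≢ z → adj G x z ≡ false → ∃[ d ] dist G x z ≡ suc (suc d)
  dist-nonadjacent {x} {z} x≢z xz =
    _ , trans (leastBelow-miss (suc n) (walks x z) (no-walk₀ x≢z))
              (cong suc (leastBelow-miss n (walks x z ∘ suc) (¬-not no-walk₁)))
    where
    no-walk₁ : reach G 1 x z ≢ true
    no-walk₁ r with reach-suc⁻ G 0 r
    ... | inj₁ xz₀ = x≢z (reach-zero⁻ G xz₀)
    ... | inj₂ (w , xw , wz) with refl ← reach-zero⁻ G xw = contradiction (trans (sym xz) wz) λ ()

  inR-left : ∀ k {x y} → x ≢ y → inR G k x y x ≡ true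
  inR-left k {x} x≢y with dist-≢ (x≢y ∘ sym)
  ... | _ , yx rewrite dist-refl x | yx = refl

  inR-right : ∀ k {x y} → x ≢ y → inR G k x y y ≡ true
  inR-right k {y = y} x≢y with dist-≢ x≢y
  ... | _ , xy rewrite dist-refl y | xy = refl

  inR-twins : ∀ k {x y z} → Twins G x y → z ≢ x → z ≢ y → inR G k x y z ≡ false
  inR-twins k {y = y} {z} xy z≢x z≢y rewrite twins-dist G xy z≢x z≢y =
    cong not (to T-≡ (≡⇒≡ᵇ (distT G k y z) _ refl))

  inR-separating : ∀ k {x y z} → z ≢ x → z ≢ y → adj G x z ≢ adj G y z → inR G (suc k) x y z ≡ true
  inR-separating k {x} {y} {z} z≢x z≢y differ with adj G x z in xz | adj G y z in yz
  ... | true  | true  = contradiction refl differ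
  ... | false | false = contradiction refl differ
  ... | true  | false with dist-nonadjacent (z≢y ∘ sym) yz
  ...   | _ , dy rewrite dist-adjacent (z≢x ∘ sym) xz | dy = refl
  inR-separating k {x} {y} {z} z≢x z≢y differ | false | true with dist-nonadjacent (z≢x ∘ sym) xz
  ...   | _ , dx rewrite dist-adjacent (z≢y ∘ sym) yz | dx = refl

-- Finite sums

q≤p+q : ∀ {p q} → 0ℚ ≤ p → q ≤ p + q
q≤p+q {p} {q} 0≤p = subst (_≤ p + q) (+-identityˡ q) (+-monoˡ-≤ q 0≤p)

0≤½ : 0ℚ ≤ ½
0≤½ = ≤ᵇ⇒≤ _

½≤1 : ½ ≤ 1ℚ
½≤1 = ≤ᵇ⇒≤ _

sumFin-nonneg : ∀ {n} {f : Fin n → ℚ} → (∀ i → 0ℚ ≤ f i) → 0ℚ ≤ sumFin f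
sumFin-nonneg {zero}  _   = ≤-refl
sumFin-nonneg {suc n} f≥0 = +-mono-≤ (f≥0 zero) (sumFin-nonneg (f≥0 ∘ suc))

sumFin-≥-point : ∀ {n} {f : Fin n → ℚ} → (∀ i → 0ℚ ≤ f i) → ∀ a → f a ≤ sumFin f
sumFin-≥-point {f = f} f≥0 zero    = subst (_≤ sumFin f) (+-identityʳ (f zero))
                                       (+-monoʳ-≤ (f zero) (sumFin-nonneg (f≥0 ∘ suc)))
sumFin-≥-point         f≥0 (suc a) = ≤-trans (sumFin-≥-point (f≥0 ∘ suc) a) (q≤p+q (f≥0 zero))

sumFin-≥-pair : ∀ {n} {f : Fin n → ℚ} → (∀ i → 0ℚ ≤ f i) → ∀ {a b} → a ≢ b → f a + f b ≤ sumFin f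
sumFin-≥-pair         f≥0 {zero}  {zero}  0≢0 = contradiction refl 0≢0
sumFin-≥-pair {f = f} f≥0 {zero}  {suc b} _   = +-monoʳ-≤ (f zero) (sumFin-≥-point (f≥0 ∘ suc) b)
sumFin-≥-pair {f = f} f≥0 {suc a} {zero}  _   =
  subst (_≤ sumFin f) (+-comm (f zero) (f (suc a))) (+-monoʳ-≤ (f zero) (sumFin-≥-point (f≥0 ∘ suc) a))
sumFin-≥-pair         f≥0 {suc a} {suc b} a≢b =
  ≤-trans (sumFin-≥-pair (f≥0 ∘ suc) (a≢b ∘ cong suc)) (q≤p+q (f≥0 zero))

sumFin-zero : ∀ {n} {f : Fin n → ℚ} → (∀ i → f i ≡ 0ℚ) → sumFin f ≡ 0ℚ
sumFin-zero {zero}  _   = refl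
sumFin-zero {suc n} f≡0 = cong₂ _+_ (f≡0 zero) (sumFin-zero (f≡0 ∘ suc))

sumFin-point : ∀ {n} {f : Fin n → ℚ} a → (∀ i → i ≢ a → f i ≡ 0ℚ) → sumFin f ≡ f a
sumFin-point {f = f} zero    vanish =
  trans (cong (_+_ (f zero)) (sumFin-zero λ i → vanish (suc i) λ ())) (+-identityʳ (f zero))
sumFin-point {f = f} (suc a) vanish =
  trans (cong₂ _+_ (vanish zero λ ()) (sumFin-point a λ i i≢a → vanish (suc i) (i≢a ∘ suc-injective)))
        (+-identityˡ (f (suc a)))

sumFin-pair : ∀ {n} {f : Fin n → ℚ} {a b} → a ≢ b → (∀ i → i ≢ a → i ≢ b → f i ≡ 0ℚ) →
  sumFin f ≡ f a + f b
sumFin-pair         {a = zero}  {zero}  0≢0 _ = contradiction refl 0≢0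
sumFin-pair {f = f} {a = zero}  {suc b} _   vanish =
  cong (_+_ (f zero)) (sumFin-point b λ i i≢b → vanish (suc i) (λ ()) (i≢b ∘ suc-injective))
sumFin-pair {f = f} {a = suc a} {zero}  _   vanish =
  trans (cong (_+_ (f zero)) (sumFin-point a λ i i≢a → vanish (suc i) (i≢a ∘ suc-injective) (λ ())))
        (+-comm (f zero) (f (suc a)))
sumFin-pair {f = f} {a = suc a} {suc b} a≢b vanish =
  trans (cong (_+ sumFin (f ∘ suc)) (vanish zero (λ ()) (λ ())))
        (trans (+-identityˡ _)
               (sumFin-pair (a≢b ∘ cong suc) λ i i≢a i≢b → vanish (suc i) (i≢a ∘ suc-injective) (i≢b ∘ suc-injective)))

sumFin-updateAt-+ : ∀ {n} (f : Fin n → ℚ) i {c} → sumFin (updateAt f i (_+ c)) ≡ sumFin f + c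
sumFin-updateAt-+ f zero    {c} = begin
  (f zero + c) + sumFin (f ∘ suc)  ≡⟨ +-assoc (f zero) c _ ⟩
  f zero + (c + sumFin (f ∘ suc))  ≡⟨ cong (_+_ (f zero)) (+-comm c _) ⟩
  f zero + (sumFin (f ∘ suc) + c)  ≡⟨ +-assoc (f zero) _ c ⟨
  (f zero + sumFin (f ∘ suc)) + c  ∎
  where open ≡-Reasoning
sumFin-updateAt-+ f (suc i) {c} =
  trans (cong (_+_ (f zero)) (sumFin-updateAt-+ (f ∘ suc) i)) (sym (+-assoc (f zero) _ c))

½+n/2 : ∀ n → ½ + + n / 2 ≡ + suc n / 2
½+n/2 n = toℚᵘ-injective (begin
  toℚᵘ (½ + + n / 2)                         ≈⟨ toℚᵘ-homo-+ ½ (+ n / 2) ⟩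
  toℚᵘ ½ ℚᵘ.+ toℚᵘ (+ n / 2)                 ≈⟨ ℚᵘ.+-cong (toℚᵘ-fromℚᵘ (ℚᵘ.mkℚᵘ (+ 1) 1)) (toℚᵘ-fromℚᵘ (ℚᵘ.mkℚᵘ (+ n) 1)) ⟩
  ℚᵘ.mkℚᵘ (+ 1) 1 ℚᵘ.+ ℚᵘ.mkℚᵘ (+ n) 1        ≈⟨ ℚᵘ.*≡* (numerators (+ n)) ⟩
  ℚᵘ.mkℚᵘ (+ suc n) 1                        ≈⟨ toℚᵘ-fromℚᵘ (ℚᵘ.mkℚᵘ (+ suc n) 1) ⟨
  toℚᵘ (+ suc n / 2)                         ∎)
  where
  open ℚᵘ.≃-Reasoning
  open ℤ-Solver.+-*-Solver
  numerators : ∀ i → (+ 1 ℤ.* + 2 ℤ.+ i ℤ.* + 2) ℤ.* + 2 ≡ (+ 1 ℤ.+ i) ℤ.* + 4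
  numerators = solve 1 (λ i → (con (+ 1) :* con (+ 2) :+ i :* con (+ 2)) :* con (+ 2) := (con (+ 1) :+ i) :* con (+ 4)) refl

sumFin-½ : ∀ n → sumFin {n} (const ½) ≡ + n / 2
sumFin-½ zero    = refl
sumFin-½ (suc n) = trans (cong (_+_ ½) (sumFin-½ n)) (½+n/2 n)

sumFin-shift-½ : ∀ {n} (h : Fin n → ℚ) → sumFin h ≡ sumFin (λ i → h i - ½) + + n / 2
sumFin-shift-½ {zero}  h = refl
sumFin-shift-½ {suc n} h = begin
  h zero + sumFin (h ∘ suc)                          ≡⟨ cong (_+_ (h zero)) (sumFin-shift-½ (h ∘ suc)) ⟩
  h zero + (sumFin g′ + + n / 2)                     ≡⟨ regroup (h zero) (sumFin g′) (+ n / 2) ⟩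
  (h zero - ½ + sumFin g′) + (½ + + n / 2)           ≡⟨ cong (_+_ (h zero - ½ + sumFin g′)) (½+n/2 n) ⟩
  (h zero - ½ + sumFin g′) + + suc n / 2             ∎
  where
  open ≡-Reasoning
  g′ = λ i → h (suc i) - ½
  regroup : ∀ a s t → a + (s + t) ≡ (a - ½ + s) + (½ + t)
  regroup = solve 3 (λ a s t → a :+ (s :+ t) := (a :- con ½ :+ s) :+ (con ½ :+ t)) refl
    where open +-*-Solver

sumOver-≥-pair : ∀ {N} (R : Fin N → Bool) (h : Fin N → ℚ) → (∀ s → 0ℚ ≤ h s) → ∀ {a b} → a ≢ b →
  R a ≡ true → R b ≡ true → h a + h b ≤ sumOver R h
sumOver-≥-pair R h h≥0 {a} {b} a≢b Ra Rb =
  subst (_≤ sumOver R h) (cong₂ _+_ (cong (λ r → if r then h a else 0ℚ) Ra) (cong (λ r → if r then h b else 0ℚ) Rb))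
    (sumFin-≥-pair restricted≥0 a≢b)
  where
  restricted≥0 : ∀ s → 0ℚ ≤ (if R s then h s else 0ℚ)
  restricted≥0 s with R s
  ... | true  = h≥0 s
  ... | false = ≤-refl

sumOver-pair : ∀ {N} (R : Fin N → Bool) (h : Fin N → ℚ) {a b} → a ≢ b → (∀ s → s ≢ a → s ≢ b → R s ≡ false) →
  R a ≡ true → R b ≡ true → sumOver R h ≡ h a + h b
sumOver-pair R h {a} {b} a≢b outside Ra Rb =
  trans (sumFin-pair a≢b λ s s≢a s≢b → cong (λ r → if r then h s else 0ℚ) (outside s s≢a s≢b))
        (cong₂ _+_ (cong (λ r → if r then h a else 0ℚ) Ra) (cong (λ r → if r then h b else 0ℚ) Rb))

PairwiseNonnegOnFibres : ∀ {n m} → (Fin n → Fin m) → (Fin n → ℚ) → Set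
PairwiseNonnegOnFibres π g = ∀ x y → x ≢ y → π x ≡ π y → 0ℚ ≤ g x + g y

NegativesShareFibre : ∀ {n m} → (Fin n → Fin m) → (Fin n → ℚ) → Set
NegativesShareFibre π g = ∀ x → 0ℚ ≤ g x ⊎ ∃[ y ] y ≢ x × π y ≡ π x

double-nonneg : ∀ {p} → 0ℚ ≤ p + p → 0ℚ ≤ p
double-nonneg {p} 0≤p+p with 0ℚ ≤? p
... | yes 0≤p = 0≤p
... | no  0≰p = contradiction (≤-<-trans 0≤p+p (+-mono-< (≰⇒> 0≰p) (≰⇒> 0≰p))) (<-irrefl refl)

triple-nonneg : ∀ {a b c} → 0ℚ ≤ a + b → 0ℚ ≤ b + c → 0ℚ ≤ a + c → 0ℚ ≤ (a + b) + c
triple-nonneg {a} {b} {c} ab bc ac =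
  double-nonneg (subst (0ℚ ≤_) (pair-sums a b c) (+-mono-≤ (+-mono-≤ ab bc) ac))
  where
  open +-*-Solver
  pair-sums : ∀ a b c → (a + b) + (b + c) + (a + c) ≡ ((a + b) + c) + ((a + b) + c)
  pair-sums = solve 3 (λ a b c → (a :+ b) :+ (b :+ c) :+ (a :+ c) := ((a :+ b) :+ c) :+ ((a :+ b) :+ c)) refl

module _ {n m} (π : Fin (suc n) → Fin m) (g : Fin (suc n) → ℚ)
         (pairs : PairwiseNonnegOnFibres π g) {y} (πy≡π0 : π (suc y) ≡ π zero) where

  private
    g′ : Fin n → ℚ
    g′ = updateAt (g ∘ suc) y (_+ g zero)

    g′-y : g′ y ≡ g (suc y) + g zero
    g′-y = updateAt-updates y (g ∘ suc)

    g′-≢ : ∀ {x} → x ≢ y → g′ x ≡ g (suc x)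
    g′-≢ {x} x≢y = updateAt-minimal x y (g ∘ suc) x≢y

    merged-pair : ∀ {x} → x ≢ y → π (suc y) ≡ π (suc x) → 0ℚ ≤ g′ y + g′ x
    merged-pair {x} x≢y πy≡πx = subst (0ℚ ≤_) (sym (cong₂ _+_ g′-y (g′-≢ x≢y))) (triple-nonneg {g (suc y)}
      (pairs (suc y) zero (λ ()) πy≡π0)
      (pairs zero (suc x) (λ ()) (trans (sym πy≡π0) πy≡πx))
      (pairs (suc y) (suc x) (x≢y ∘ sym ∘ suc-injective) πy≡πx))

  merge-head-pairs : PairwiseNonnegOnFibres (π ∘ suc) g′
  merge-head-pairs x x′ x≢x′ πx≡πx′ with x ≟ y | x′ ≟ y
  ... | yes refl | yes refl = contradiction refl x≢x′
  ... | yes refl | no x′≢y  = merged-pair x′≢y πx≡πx′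
  ... | no x≢y   | yes refl = subst (0ℚ ≤_) (+-comm (g′ x′) (g′ x)) (merged-pair x≢y (sym πx≡πx′))
  ... | no x≢y   | no x′≢y  =
    subst (0ℚ ≤_) (sym (cong₂ _+_ (g′-≢ x≢y) (g′-≢ x′≢y))) (pairs (suc x) (suc x′) (x≢x′ ∘ suc-injective) πx≡πx′)

  merge-head-shares : NegativesShareFibre π g → NegativesShareFibre (π ∘ suc) g′
  merge-head-shares shares x with x ≟ y
  ... | yes refl = inj₁ (subst (0ℚ ≤_) (sym g′-y) (pairs (suc y) zero (λ ()) πy≡π0))
  ... | no x≢y with shares (suc x)
  ...   | inj₁ 0≤gx                  = inj₁ (subst (0ℚ ≤_) (sym (g′-≢ x≢y)) 0≤gx)
  ...   | inj₂ (zero  , _    , π0≡πx) = inj₂ (y , x≢y ∘ sym , trans πy≡π0 π0≡πx)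
  ...   | inj₂ (suc w , w≢x , πw≡πx) = inj₂ (w , w≢x ∘ cong suc , πw≡πx)

  merge-head-sum : sumFin g′ ≡ sumFin g
  merge-head-sum = trans (sumFin-updateAt-+ (g ∘ suc) y) (+-comm _ (g zero))

module _ {n m} (π : Fin (suc n) → Fin m) (g : Fin (suc n) → ℚ)
         (alone : ¬ (∃[ y ] π (suc y) ≡ π zero)) where

  drop-head-pairs : PairwiseNonnegOnFibres π g → PairwiseNonnegOnFibres (π ∘ suc) (g ∘ suc)
  drop-head-pairs pairs x x′ x≢x′ = pairs (suc x) (suc x′) (x≢x′ ∘ suc-injective)

  drop-head-shares : NegativesShareFibre π g → NegativesShareFibre (π ∘ suc) (g ∘ suc)
  drop-head-shares shares x with shares (suc x)
  ... | inj₁ 0≤gx                  = inj₁ 0≤gx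
  ... | inj₂ (zero  , _   , π0≡πx) = contradiction (x , sym π0≡πx) alone
  ... | inj₂ (suc w , w≢x , πw≡πx) = inj₂ (w , w≢x ∘ cong suc , πw≡πx)

  drop-head-nonneg : NegativesShareFibre π g → 0ℚ ≤ g zero
  drop-head-nonneg shares with shares zero
  ... | inj₁ 0≤g0              = 0≤g0
  ... | inj₂ (zero  , 0≢0 , _) = contradiction refl 0≢0
  ... | inj₂ (suc w , _ , πw≡π0) = contradiction (w , πw≡π0) alone

-- If the head point has a fibre-mate, its weight is moved onto that mate (the pair
-- condition survives by triple-nonneg); otherwise its own weight is nonnegative.
sumFin-nonneg-on-fibres : ∀ {n m} (π : Fin n → Fin m) (g : Fin n → ℚ) →
  PairwiseNonnegOnFibres π g → NegativesShareFibre π g → 0ℚ ≤ sumFin g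
sumFin-nonneg-on-fibres {zero}  π g pairs shares = ≤-refl
sumFin-nonneg-on-fibres {suc n} π g pairs shares with any? (λ y → π (suc y) ≟ π zero)
... | yes (y , πy≡π0) = subst (0ℚ ≤_) (merge-head-sum π g pairs πy≡π0)
  (sumFin-nonneg-on-fibres (π ∘ suc) _ (merge-head-pairs π g pairs πy≡π0) (merge-head-shares π g pairs πy≡π0 shares))
... | no alone = +-mono-≤ (drop-head-nonneg π g alone shares)
  (sumFin-nonneg-on-fibres (π ∘ suc) (g ∘ suc) (drop-head-pairs π g alone pairs) (drop-head-shares π g alone shares))

-- Finite quotients

record Quotient {n ℓ} (_≈_ : Rel (Fin n) ℓ) : Set ℓ where
  field
    size  : ℕ
    [_]   : Fin n → Fin size
    rep   : Fin size → Fin n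
    [rep] : ∀ i → [ rep i ] ≡ i
    sound : ∀ {x y} → x ≈ y → [ x ] ≡ [ y ]
    exact : ∀ {x y} → [ x ] ≡ [ y ] → x ≈ y

module _ {n ℓ} {_≈_ : Rel (Fin (suc n)) ℓ} (≈-dec : IsDecEquivalence _≈_)
         (Q : Quotient (λ x y → suc x ≈ suc y)) where

  private
    module E = IsDecEquivalence ≈-dec
    module Q = Quotient Q

  quotient-join-head : ∀ y → zero ≈ suc y → Quotient _≈_
  quotient-join-head y 0≈y = record
    { size = Q.size ; [_] = cls ; rep = suc ∘ Q.rep ; [rep] = Q.[rep] ; sound = sound ; exact = exact }
    where
    cls : Fin (suc n) → Fin Q.size
    cls zero    = Q.[ y ]
    cls (suc x) = Q.[ x ]
    sound : ∀ {x x′} → x ≈ x′ → cls x ≡ cls x′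
    sound {zero}  {zero}   _     = refl
    sound {zero}  {suc x′} 0≈x′  = Q.sound (E.trans (E.sym 0≈y) 0≈x′)
    sound {suc x} {zero}   x≈0   = Q.sound (E.trans x≈0 0≈y)
    sound {suc x} {suc x′} x≈x′  = Q.sound x≈x′
    exact : ∀ {x x′} → cls x ≡ cls x′ → x ≈ x′
    exact {zero}  {zero}   _ = E.refl
    exact {zero}  {suc x′} e = E.trans 0≈y (Q.exact e)
    exact {suc x} {zero}   e = E.trans (Q.exact e) (E.sym 0≈y)
    exact {suc x} {suc x′} e = Q.exact e

  quotient-new-head : (∀ y → ¬ zero ≈ suc y) → Quotient _≈_
  quotient-new-head alone = record
    { size = suc Q.size ; [_] = cls ; rep = rep ; [rep] = cls∘rep ; sound = sound ; exact = exact }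
    where
    cls : Fin (suc n) → Fin (suc Q.size)
    cls zero    = zero
    cls (suc x) = suc Q.[ x ]
    rep : Fin (suc Q.size) → Fin (suc n)
    rep zero    = zero
    rep (suc i) = suc (Q.rep i)
    cls∘rep : ∀ i → cls (rep i) ≡ i
    cls∘rep zero    = refl
    cls∘rep (suc i) = cong suc (Q.[rep] i)
    sound : ∀ {x x′} → x ≈ x′ → cls x ≡ cls x′
    sound {zero}  {zero}   _    = refl
    sound {zero}  {suc x′} 0≈x′ = contradiction 0≈x′ (alone x′)
    sound {suc x} {zero}   x≈0  = contradiction (E.sym x≈0) (alone x)
    sound {suc x} {suc x′} x≈x′ = cong suc (Q.sound x≈x′)
    exact : ∀ {x x′} → cls x ≡ cls x′ → x ≈ x′
    exact {zero}  {zero}   _ = E.refl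
    exact {suc x} {suc x′} e = Q.exact (suc-injective e)

quotient : ∀ {n ℓ} {_≈_ : Rel (Fin n) ℓ} → IsDecEquivalence _≈_ → Quotient _≈_
quotient {zero} _ = record
  { size = 0 ; [_] = λ () ; rep = λ () ; [rep] = λ () ; sound = λ { {()} } ; exact = λ { {()} } }
quotient {suc n} ≈-dec with any? (λ y → IsDecEquivalence._≟_ ≈-dec zero (suc y))
... | yes (y , 0≈y) = quotient-join-head ≈-dec (quotient (On.isDecEquivalence suc ≈-dec)) y 0≈y
... | no alone      = quotient-new-head ≈-dec (quotient (On.isDecEquivalence suc ≈-dec)) (λ y 0≈y → alone (y , 0≈y))

-- Blow-ups

comap : ∀ {n m} → Graph n → (Fin m → Fin n) → Graph m
comap G f = record
  { adj = λ i j → adj G (f i) (f j) ; sym = λ i j → Graph.sym G (f i) (f j) ; irrefl = λ i → Graph.irrefl G (f i) }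

module _ {n} (G : Graph n) where

  blowup-fibre-twins : ∀ {m} {H : Graph m} (blowup : InBlowup G H) {x y} →
    proj₁ blowup x ≡ proj₁ blowup y → Twins G x y
  blowup-fibre-twins {H = H} (π , _ , uniform , cross) {x} {y} πx≡πy z z≢x z≢y with π z ≟ π x | uniform (π x)
  ... | yes πz≡πx | inj₁ clique =
    trans (clique x z refl πz≡πx (z≢x ∘ sym)) (sym (clique y z (sym πx≡πy) πz≡πx (z≢y ∘ sym)))
  ... | yes πz≡πx | inj₂ independent =
    trans (independent x z refl πz≡πx) (sym (independent y z (sym πx≡πy) πz≡πx))
  ... | no πz≢πx  | _ = begin
    adj G x z          ≡⟨ cross x z (πz≢πx ∘ sym) ⟩
    adj H (π x) (π z)  ≡⟨ cong (λ i → adj H i (π z)) πx≡πy ⟩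
    adj H (π y) (π z)  ≡⟨ cross y z (λ πy≡πz → πz≢πx (trans (sym πy≡πz) (sym πx≡πy))) ⟨
    adj G y z          ∎
    where open ≡-Reasoning

  blowup⇒twins : ∀ {m} {H : Graph m} → InBlowup G H → EveryVertexHasTwin G
  blowup⇒twins {H = H} blowup@(π , fibre-pair , _) x with fibre-pair (π x)
  ... | a , b , a≢b , πa≡πx , πb≡πx with a ≟ x
  ...   | yes refl = b , a≢b , blowup-fibre-twins {H = H} blowup (sym πb≡πx)
  ...   | no a≢x   = a , a≢x ∘ sym , blowup-fibre-twins {H = H} blowup (sym πa≡πx)

  twins⇒blowup : Connected G → EveryVertexHasTwin G → InSomeBlowup G
  twins⇒blowup connected twin = size , H , H-connected , [_] , fibre-pair , uniform , cross
    where
    open Quotient (quotient (twins-isDecEquivalence G))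
    H : Graph size
    H = comap G rep

    rep-twin : ∀ x → Twins G x (rep [ x ])
    rep-twin x = exact (sym ([rep] [ x ]))

    cross : ∀ x y → [ x ] ≢ [ y ] → adj G x y ≡ adj H [ x ] [ y ]
    cross x y [x]≢[y] = adj-cong-twins G (rep-twin x) (rep-twin y) ([x]≢[y] ∘ cong [_])
      (λ rep≡rep → [x]≢[y] (trans (sym ([rep] [ x ])) (trans (cong [_] rep≡rep) ([rep] [ y ]))))

    mate : Fin size → Fin n
    mate i = proj₁ (twin (rep i))

    rep≢mate : ∀ i → rep i ≢ mate i
    rep≢mate i = proj₁ (proj₂ (twin (rep i)))

    [mate] : ∀ i → [ mate i ] ≡ i
    [mate] i = trans (sym (sound (proj₂ (proj₂ (twin (rep i)))))) ([rep] i)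

    fibre-pair : ∀ i → ∃[ x ] ∃[ y ] x ≢ y × [ x ] ≡ i × [ y ] ≡ i
    fibre-pair i = rep i , mate i , rep≢mate i , [rep] i , [mate] i

    same-adj : ∀ {i x y} → [ x ] ≡ i → [ y ] ≡ i → x ≢ y → adj G x y ≡ adj G (rep i) (mate i)
    same-adj {i} [x]≡i [y]≡i x≢y = adj-cong-twins G
      (exact (trans [x]≡i (sym ([rep] i)))) (exact (trans [y]≡i (sym ([mate] i)))) x≢y (rep≢mate i)

    uniform : ∀ i → (∀ x y → [ x ] ≡ i → [ y ] ≡ i → x ≢ y → adj G x y ≡ true)
                  ⊎ (∀ x y → [ x ] ≡ i → [ y ] ≡ i → adj G x y ≡ false)
    uniform i with adj G (rep i) (mate i) in rep~mate
    ... | true  = inj₁ λ x y [x]≡i [y]≡i x≢y → trans (same-adj [x]≡i [y]≡i x≢y) rep~mate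
    ... | false = inj₂ λ x y [x]≡i [y]≡i → non-edge x y [x]≡i [y]≡i (x ≟ y)
      where
      non-edge : ∀ x y → [ x ] ≡ i → [ y ] ≡ i → Dec (x ≡ y) → adj G x y ≡ false
      non-edge x _ _      _      (yes refl) = Graph.irrefl G x
      non-edge x y [x]≡i [y]≡i (no x≢y)   = trans (same-adj [x]≡i [y]≡i x≢y) rep~mate

    H-connected : Connected H
    H-connected = connected-image [_] edge rep [rep] connected
      where
      edge : ∀ {x y} → adj G x y ≡ true → [ x ] ≡ [ y ] ⊎ adj H [ x ] [ y ] ≡ true
      edge {x} {y} xy with [ x ] ≟ [ y ]
      ... | yes [x]≡[y] = inj₁ [x]≡[y]
      ... | no [x]≢[y]  = inj₂ (trans (sym (cross x y [x]≢[y])) xy)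

  blowup⇔twins : Connected G → InSomeBlowup G ⇔ EveryVertexHasTwin G
  blowup⇔twins connected = mk⇔ (λ (_ , H , _ , blowup) → blowup⇒twins {H = H} blowup) (twins⇒blowup connected)

-- Fractional truncated metric dimension

module _ {n} (G : Graph (suc (suc n))) where

  private
    N : ℕ
    N = suc (suc n)

  module _ (k : ℕ) where

    resolving-by-pairs : ∀ {h : Fin N → ℚ} → (∀ s → 0ℚ ≤ h s × h s ≤ 1ℚ) →
      (∀ x y → x ≢ y → ∃[ a ] ∃[ b ] a ≢ b × inR G k x y a ≡ true × inR G k x y b ≡ true × 1ℚ ≤ h a + h b) →
      IsTruncResolving G k h
    resolving-by-pairs bounds witnesses = bounds , λ x y x≢y →
      let a , b , a≢b , Ra , Rb , 1≤ha+hb = witnesses x y x≢y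
      in ≤-trans 1≤ha+hb (sumOver-≥-pair (inR G k x y) _ (proj₁ ∘ bounds) a≢b Ra Rb)

    ½-resolving : IsTruncResolving G k (const ½)
    ½-resolving = resolving-by-pairs (λ _ → 0≤½ , ½≤1)
      λ x y x≢y → x , y , x≢y , inR-left G k x≢y , inR-right G k x≢y , ≤-refl

    twin-bound : ∀ {h x y} → IsTruncResolving G k h → x ≢ y → Twins G x y → 1ℚ ≤ h x + h y
    twin-bound {h} {x} {y} (_ , resolves) x≢y xy = ≤-trans (resolves _ _ x≢y) (≤-reflexive
      (sumOver-pair (inR G k x y) h x≢y (λ _ → inR-twins G k xy) (inR-left G k x≢y) (inR-right G k x≢y)))

    resolving-≥-half : EveryVertexHasTwin G → ∀ {h} → IsTruncResolving G k h → + N / 2 ≤ sumFin h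
    resolving-≥-half twin {h} resolving = begin
      + N / 2                   ≡⟨ +-identityˡ (+ N / 2) ⟨
      0ℚ + + N / 2              ≤⟨ +-monoˡ-≤ (+ N / 2) (sumFin-nonneg-on-fibres [_] g pairs shares) ⟩
      sumFin g + + N / 2        ≡⟨ sumFin-shift-½ h ⟨
      sumFin h                  ∎
      where
      open ≤-Reasoning
      open Quotient (quotient (twins-isDecEquivalence G))
      g : Fin N → ℚ
      g x = h x - ½
      pairs : PairwiseNonnegOnFibres [_] g
      pairs x y x≢y [x]≡[y] = subst (0ℚ ≤_) (recentre (h x) (h y))
        (+-monoˡ-≤ (- 1ℚ) (twin-bound resolving x≢y (exact [x]≡[y])))
        where
        open +-*-Solver
        recentre : ∀ a b → (a + b) - 1ℚ ≡ (a - ½) + (b - ½)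
        recentre = solve 2 (λ a b → (a :+ b) :- con 1ℚ := (a :- con ½) :+ (b :- con ½)) refl
      shares : NegativesShareFibre [_] g
      shares x with twin x
      ... | y , x≢y , xy = inj₂ (y , x≢y ∘ sym , sym (sound xy))

    twins⇒dim-half : EveryVertexHasTwin G → DimKF≡ G k (+ N / 2)
    twins⇒dim-half twin = (const ½ , ½-resolving , sumFin-½ N) , λ _ → resolving-≥-half twin

  -- The value at x is ½ - ½ = 0, written as a shift so that sumFin-updateAt-+ applies.
  halfExcept : Fin N → Fin N → ℚ
  halfExcept x = updateAt (const ½) x (_- ½)

  halfExcept-≢ : ∀ {x s} → s ≢ x → halfExcept x s ≡ ½
  halfExcept-≢ {x} {s} s≢x = updateAt-minimal s x (const ½) s≢x

  halfExcept-bounds : ∀ x s → 0ℚ ≤ halfExcept x s × halfExcept x s ≤ 1ℚ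
  halfExcept-bounds x s with s ≟ x
  ... | yes refl rewrite updateAt-updates x {_- ½} (const ½) = ≤-refl , ≤ᵇ⇒≤ _
  ... | no s≢x   rewrite halfExcept-≢ s≢x = 0≤½ , ½≤1

  sumFin-halfExcept : ∀ x → sumFin (halfExcept x) < + N / 2
  sumFin-halfExcept x = begin-strict
    sumFin (halfExcept x)     ≡⟨ sumFin-updateAt-+ (const ½) x ⟩
    sumFin {N} (const ½) - ½  ≡⟨ cong (_- ½) (sumFin-½ N) ⟩
    + N / 2 - ½               <⟨ +-monoʳ-< (+ N / 2) (negative⁻¹ -½) ⟩
    + N / 2 + 0ℚ              ≡⟨ +-identityʳ (+ N / 2) ⟩
    + N / 2                   ∎
    where open ≤-Reasoning

  twinless-resolving : ∀ k {x} → ¬ HasTwin G x → IsTruncResolving G (suc k) (halfExcept x)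
  twinless-resolving k {x} twinless = resolving-by-pairs (suc k) (halfExcept-bounds x) witnesses
    where
    halves : ∀ {a b} → a ≢ x → b ≢ x → 1ℚ ≤ halfExcept x a + halfExcept x b
    halves a≢x b≢x = ≤-reflexive (sym (cong₂ _+_ (halfExcept-≢ a≢x) (halfExcept-≢ b≢x)))
    separator : ∀ {y} → x ≢ y → ∃[ z ] z ≢ x × z ≢ y × adj G x z ≢ adj G y z
    separator x≢y = separating-vertex G λ xy → twinless (_ , x≢y , xy)
    witnesses : ∀ a b → a ≢ b → ∃[ c ] ∃[ d ] c ≢ d × inR G (suc k) a b c ≡ true × inR G (suc k) a b d ≡ true
                × 1ℚ ≤ halfExcept x c + halfExcept x d
    witnesses a b a≢b with a ≟ x | b ≟ x
    ... | yes refl | yes refl = contradiction refl a≢b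
    ... | yes refl | no b≢x with separator (b≢x ∘ sym)
    ...   | z , z≢a , z≢b , differ =
      b , z , z≢b ∘ sym , inR-right G (suc k) a≢b , inR-separating G k z≢a z≢b differ , halves b≢x z≢a
    witnesses a b a≢b | no a≢x | yes refl with separator (a≢x ∘ sym)
    ...   | z , z≢b , z≢a , differ =
      a , z , z≢a ∘ sym , inR-left G (suc k) a≢b , inR-separating G k z≢a z≢b (differ ∘ sym) , halves a≢x z≢b
    witnesses a b a≢b | no a≢x | no b≢x =
      a , b , a≢b , inR-left G (suc k) a≢b , inR-right G (suc k) a≢b , halves a≢x b≢x

  dim-half⇒twins : ∀ k → DimKF≡ G (suc k) (+ N / 2) → EveryVertexHasTwin G
  dim-half⇒twins k (_ , minimal) x with any? (λ y → ¬? (x ≟ y) ×-dec twins? G x y)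
  ... | yes twin    = twin
  ... | no twinless = contradiction
    (≤-<-trans (minimal _ (twinless-resolving k twinless)) (sumFin-halfExcept x)) (<-irrefl refl)

  dim-half⇔twins : ∀ k → DimKF≡ G (suc k) (+ N / 2) ⇔ EveryVertexHasTwin G
  dim-half⇔twins k = mk⇔ (dim-half⇒twins k) (twins⇒dim-half (suc k))

corollary2p9 : (n : ℕ) → 2 ℕ.≤ n → (G : Graph n) → Connected G →
    (k : ℕ) → 1 ℕ.≤ k →
    DimKF≡ G k ((+ n) / 2) ⇔ InSomeBlowup G
corollary2p9 (suc (suc n)) _ G connected (suc k) _ =
  ⇔.trans (dim-half⇔twins G k) (⇔.sym (blowup⇔twins G connected))
corollary2p9 (suc (suc n)) _ G _ zero ()
corollary2p9 (suc zero) (s≤s ())
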